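{- Let $\mathbb{A}=\mathbb{F}_2[x]$ and $\mathbb{M}$ the set of monic polynomials in $\mathbb{A}$. For non-constant $f\in\mathbb{A}$ let $\Phi(f)=|(\mathbb{A}/f\mathbb{A})^*|$, let $\Phi(\mathbb{A})$ be the set of values of $\Phi$ on non-constant polynomials, and for a positive integer $n$ let $\Phi^{ -1}(n)\cap\mathbb{M}$ be the set of non-constant monic $f$ with $\Phi(f)=n$. Then for every $n\in\Phi(\mathbb{A})$ we have $|\Phi^{ -1}(n)\cap\mathbb{M}|\ge 3$, and equality holds only when $n=1$. -}

module Defs where

open import Data.Bool using (Bool; true; false; _xor_; _∧_; if_then_else_)
open import Data.Nat using (ℕ; zero; suc; _≤_; _∸_)
open import Data.List using (List; []; _∷_; length; map; filterᵇ; replicate; foldr; _++_; take)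
open import Data.Bool.ListAction using (any)
open import Data.Product using (Σ; _×_)
open import Relation.Binary.PropositionalEquality using (_≡_)

-- Polynomials over 𝔽₂ = Bool (xor = +, ∧ = ·), as coefficient lists,
-- lowest degree first: [a₀, a₁, …, a_d] represents a₀ + a₁x + … + a_d x^d.
Poly : Set
Poly = List Bool

normalize : Poly → Poly
normalize [] = []
normalize (b ∷ p) with normalize p
... | [] = if b then b ∷ [] else []
... | q@(_ ∷ _) = b ∷ q

Normal : Poly → Set
Normal p = normalize p ≡ p

-- leading coefficient (of a normal polynomial); 0 for the zero polynomial
lead : Poly → Bool
lead [] = false
lead (b ∷ []) = b
lead (_ ∷ p@(_ ∷ _)) = lead p

Monic : Poly → Set
Monic p = lead p ≡ true

-- non-constant: degree ≥ 1 (for normal p, i.e. at least 2 coefficients)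
NonConst : Poly → Set
NonConst p = 2 ≤ length p

_+ₚ_ : Poly → Poly → Poly
[] +ₚ q = q
(a ∷ p) +ₚ [] = a ∷ p
(a ∷ p) +ₚ (b ∷ q) = (a xor b) ∷ (p +ₚ q)

_*ₚ_ : Poly → Poly → Poly
[] *ₚ q = []
(b ∷ p) *ₚ q = (if b then q else []) +ₚ (false ∷ (p *ₚ q))

-- degree of a normal polynomial (0 for constants)
deg : Poly → ℕ
deg p = length (normalize p) ∸ 1

eqᵇ : List Bool → List Bool → Bool
eqᵇ [] [] = true
eqᵇ (a ∷ p) (b ∷ q) = (if a then b else (if b then false else true)) ∧ eqᵇ p q
eqᵇ _ _ = false

lastOr : Bool → List Bool → Bool
lastOr d [] = d
lastOr d (b ∷ p) = lastOr b p

-- The quotient ring 𝔸/f𝔸 for non-constant f of degree d is represented by the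
-- standard residues: coefficient lists of length exactly d (degree < d).
-- lowPart f = [f₀, …, f_{d-1}] (f normalised, so f_d = 1).
lowPart : Poly → Poly
lowPart f = take (deg f) (normalize f)

-- one Horner step: r ↦ (x·r + c) mod f, for r a residue of length d ≥ 1
step : Poly → Bool → List Bool → List Bool
step f c r =
  let body = take (deg f) (c ∷ r)
  in if lastOr false r then body +ₚ lowPart f else body

modₚ : Poly → Poly → List Bool
modₚ f g = foldr (step f) (replicate (deg f) false) g

-- all lists of Booleans of length d = all residues mod a degree-d polynomial
allBits : ℕ → List (List Bool)
allBits zero = [] ∷ []
allBits (suc d) = map (false ∷_) (allBits d) ++ map (true ∷_) (allBits d)

mulMod : Poly → List Bool → List Bool → List Bool
mulMod f g h = modₚ f (g *ₚ h)

isUnitᵇ : Poly → List Bool → Bool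
isUnitᵇ f g = any (λ h → eqᵇ (mulMod f g h) (modₚ f (true ∷ []))) (allBits (deg f))

Φ : Poly → ℕ
Φ f = length (filterᵇ (isUnitᵇ f) (allBits (deg f)))

InImage : ℕ → Set
InImage n = Σ Poly (λ f → Normal f × NonConst f × Φ f ≡ n)

InPreimage : ℕ → Poly → Set
InPreimage n f = Normal f × Monic f × NonConst f × Φ f ≡ n

{-# OPTIONS --safe #-}
-- Every non-constant monic f factors as xᵃ(x + 1)ᵇg with g(0) = g(1) = 1. Multiplying h by
-- x + c leaves Φ unchanged when h(c) = 1 (the units modulo (x + c)h are the units modulo h
-- that do not vanish at c) and doubles it when h(c) = 0, so Φ(f) = Φ(xᵃ)Φ(xᵇ)Φ(g), and this
-- product is Φ(x^K)Φ(g) for some K, where Φ(x⁰) = Φ(x¹) = 1 and Φ(x^(k+2)) = 2^(k+1).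
-- If K ≤ 1, then Φ(f) = Φ(g) is the value of Φ at g, xg, (x + 1)g and x(x + 1)g; when g = 1
-- only the last three are non-constant, but then Φ(f) = 1. If K ≥ 2, then Φ(f) is the value of
-- Φ at x^K g, x^K(x + 1)g, (x + 1)^K g and x(x + 1)^K g.
module Submission where

open import Defs renaming (_+ₚ_ to infixl 6 _+ₚ_; _*ₚ_ to infixl 7 _*ₚ_)
open import Data.Nat using (ℕ)
open import Data.Product using (_×_; ∃-syntax)
open import Relation.Binary.PropositionalEquality using (_≡_; _≢_)

open import Algebra.Bundles using (CommutativeRing; CommutativeMonoid)
open import Algebra.Structures using (IsCommutativeRing; IsCommutativeMonoid)
import Algebra.Properties.CommutativeSemigroup as CommutativeSemigroupProperties
open import Data.Bool using (Bool; true; false; _xor_; _∧_; not; if_then_else_; T)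
open import Data.Bool.Properties
  using ( T-≡; T-∧; xor-same; xor-comm; xor-assoc; xor-identityʳ; ∧-zeroʳ; ∧-identityʳ; ∧-assoc; ∧-comm
        ; ∧-distribˡ-xor; ∧-distribʳ-xor; xor-∧-commutativeRing)
open import Data.Empty using (⊥-elim)
open import Data.List using (List; []; _∷_; _∷ʳ_; _++_; length; take; map; replicate; filterᵇ)
open import Data.List.Membership.Propositional using (_∈_; lose)
open import Data.List.Membership.Propositional.Properties using (∈-++⁺ˡ; ∈-++⁺ʳ; ∈-map⁺)
open import Data.List.Properties using (length-++; length-take; length-replicate; filter-++)
open import Data.List.Relation.Unary.Any using (here; satisfied)
open import Data.List.Relation.Unary.Any.Properties using (any⁺; any⁻)
open import Data.Nat using (zero; suc; _+_; _*_; _^_; _∸_; _≤_; z≤n; s≤s)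
import Data.Nat.Properties as ℕ
open import Data.Product using (_,_; proj₁; proj₂)
open import Data.Product.Function.NonDependent.Propositional using (_×-⇔_)
open import Data.Sum using (_⊎_; inj₁; inj₂)
open import Data.Unit using (tt)
open import Function using (id; _∘_; _$_; _⇔_; mk⇔; Equivalence)
open import Function.Construct.Composition using () renaming (equivalence to ⇔-trans)
open import Function.Construct.Symmetry using (⇔-sym)
open import Level using (0ℓ)
open import Relation.Binary.Bundles using (Setoid)
open import Relation.Binary.PropositionalEquality using (refl; sym; trans; cong; cong₂; subst; module ≡-Reasoning)
import Relation.Binary.Reasoning.Setoid as SetoidReasoning
open import Relation.Binary.Structures using (IsEquivalence)
open import Relation.Nullary using (¬_; contradiction)
open import Relation.Nullary.Decidable using (T?)

-- The ring 𝔽₂[x], with coefficientwise equality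

1ₚ : Poly
1ₚ = true ∷ []

coeff : Poly → ℕ → Bool
coeff []      i       = false
coeff (b ∷ p) zero    = b
coeff (b ∷ p) (suc i) = coeff p i

infix 4 _≈_
record _≈_ (p q : Poly) : Set where
  constructor pointwise
  field coeff-≡ : ∀ i → coeff p i ≡ coeff q i
open _≈_

≈-isEquivalence : IsEquivalence _≈_
≈-isEquivalence = record
  { refl  = pointwise λ _ → refl
  ; sym   = λ p≈q → pointwise λ i → sym (coeff-≡ p≈q i)
  ; trans = λ p≈q q≈r → pointwise λ i → trans (coeff-≡ p≈q i) (coeff-≡ q≈r i)
  }

open IsEquivalence ≈-isEquivalence using ()
  renaming (refl to ≈-refl; sym to ≈-sym; trans to ≈-trans; reflexive to ≈-reflexive)

≈-setoid : Setoid 0ℓ 0ℓ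
≈-setoid = record { isEquivalence = ≈-isEquivalence }

module ≈-Reasoning = SetoidReasoning ≈-setoid

∷-cong : ∀ {a b p q} → a ≡ b → p ≈ q → a ∷ p ≈ b ∷ q
∷-cong refl p≈q = pointwise λ { zero → refl ; (suc i) → coeff-≡ p≈q i }

∷-injective : ∀ {a b p q} → a ∷ p ≈ b ∷ q → a ≡ b × p ≈ q
∷-injective a∷p≈b∷q = coeff-≡ a∷p≈b∷q zero , pointwise λ i → coeff-≡ a∷p≈b∷q (suc i)

∷-≈0 : ∀ {b p} → b ∷ p ≈ [] → b ≡ false × p ≈ []
∷-≈0 b∷p≈0 = coeff-≡ b∷p≈0 zero , pointwise λ i → coeff-≡ b∷p≈0 (suc i)

0∷0≈0 : false ∷ [] ≈ []
0∷0≈0 = pointwise λ { zero → refl ; (suc i) → refl }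

coeff-+ : ∀ p q i → coeff (p +ₚ q) i ≡ coeff p i xor coeff q i
coeff-+ []      q       i       = refl
coeff-+ (a ∷ p) []      i       = sym (xor-identityʳ _)
coeff-+ (a ∷ p) (b ∷ q) zero    = refl
coeff-+ (a ∷ p) (b ∷ q) (suc i) = coeff-+ p q i

+-cong : ∀ {p p′ q q′} → p ≈ p′ → q ≈ q′ → p +ₚ q ≈ p′ +ₚ q′
+-cong {p} {p′} {q} {q′} p≈p′ q≈q′ = pointwise λ i → begin
  coeff (p +ₚ q) i           ≡⟨ coeff-+ p q i ⟩
  coeff p i xor coeff q i    ≡⟨ cong₂ _xor_ (coeff-≡ p≈p′ i) (coeff-≡ q≈q′ i) ⟩
  coeff p′ i xor coeff q′ i  ≡⟨ coeff-+ p′ q′ i ⟨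
  coeff (p′ +ₚ q′) i         ∎
  where open ≡-Reasoning

+-congˡ : ∀ p {q q′} → q ≈ q′ → p +ₚ q ≈ p +ₚ q′
+-congˡ p = +-cong ≈-refl

+-congʳ : ∀ {p p′} q → p ≈ p′ → p +ₚ q ≈ p′ +ₚ q
+-congʳ q p≈p′ = +-cong p≈p′ ≈-refl

+-assoc : ∀ p q r → (p +ₚ q) +ₚ r ≈ p +ₚ (q +ₚ r)
+-assoc p q r = pointwise λ i → begin
  coeff ((p +ₚ q) +ₚ r) i                    ≡⟨ coeff-+ (p +ₚ q) r i ⟩
  coeff (p +ₚ q) i xor coeff r i             ≡⟨ cong (_xor coeff r i) (coeff-+ p q i) ⟩
  (coeff p i xor coeff q i) xor coeff r i    ≡⟨ xor-assoc (coeff p i) _ _ ⟩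
  coeff p i xor (coeff q i xor coeff r i)    ≡⟨ cong (coeff p i xor_) (coeff-+ q r i) ⟨
  coeff p i xor coeff (q +ₚ r) i             ≡⟨ coeff-+ p (q +ₚ r) i ⟨
  coeff (p +ₚ (q +ₚ r)) i                    ∎
  where open ≡-Reasoning

+-comm : ∀ p q → p +ₚ q ≈ q +ₚ p
+-comm p q = pointwise λ i → begin
  coeff (p +ₚ q) i         ≡⟨ coeff-+ p q i ⟩
  coeff p i xor coeff q i  ≡⟨ xor-comm (coeff p i) _ ⟩
  coeff q i xor coeff p i  ≡⟨ coeff-+ q p i ⟨
  coeff (q +ₚ p) i         ∎
  where open ≡-Reasoning

+-identityʳ : ∀ p → p +ₚ [] ≈ p
+-identityʳ p = pointwise λ i → trans (coeff-+ p [] i) (xor-identityʳ (coeff p i))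

+-self : ∀ p → p +ₚ p ≈ []
+-self p = pointwise λ i → trans (coeff-+ p p i) (xor-same (coeff p i))

+-cancelˡ : ∀ p q → p +ₚ (p +ₚ q) ≈ q
+-cancelˡ p q = ≈-trans (≈-sym (+-assoc p p q)) (+-congʳ q (+-self p))

+-isCommutativeMonoid : IsCommutativeMonoid _≈_ _+ₚ_ []
+-isCommutativeMonoid = record
  { isMonoid = record
    { isSemigroup = record
      { isMagma = record { isEquivalence = ≈-isEquivalence ; ∙-cong = +-cong }
      ; assoc   = +-assoc
      }
    ; identity = (λ _ → ≈-refl) , +-identityʳ
    }
  ; comm = +-comm
  }

+-commutativeMonoid : CommutativeMonoid 0ℓ 0ℓ
+-commutativeMonoid = record { isCommutativeMonoid = +-isCommutativeMonoid }

open CommutativeSemigroupProperties (CommutativeMonoid.commutativeSemigroup +-commutativeMonoid)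
  using () renaming (interchange to +-interchange; x∙yz≈y∙xz to +-left-comm; xy∙z≈xz∙y to +-right-comm)

scale : Bool → Poly → Poly
scale b q = if b then q else []

coeff-scale : ∀ b q i → coeff (scale b q) i ≡ b ∧ coeff q i
coeff-scale true  q i = refl
coeff-scale false q i = refl

scale-cong : ∀ b {q q′} → q ≈ q′ → scale b q ≈ scale b q′
scale-cong true  q≈q′ = q≈q′
scale-cong false q≈q′ = ≈-refl

scale-zero : ∀ b → scale b [] ≈ []
scale-zero true  = ≈-refl
scale-zero false = ≈-refl

scale-∷ : ∀ a b p → scale a (b ∷ p) ≈ (a ∧ b) ∷ scale a p
scale-∷ true  b p = ≈-refl
scale-∷ false b p = ≈-sym 0∷0≈0

scale-distrib-xor : ∀ a b q → scale (a xor b) q ≈ scale a q +ₚ scale b q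
scale-distrib-xor a b q = pointwise λ i → begin
  coeff (scale (a xor b) q) i                     ≡⟨ coeff-scale (a xor b) q i ⟩
  (a xor b) ∧ coeff q i                           ≡⟨ ∧-distribʳ-xor (coeff q i) a b ⟩
  (a ∧ coeff q i) xor (b ∧ coeff q i)             ≡⟨ cong₂ _xor_ (coeff-scale a q i) (coeff-scale b q i) ⟨
  coeff (scale a q) i xor coeff (scale b q) i     ≡⟨ coeff-+ (scale a q) (scale b q) i ⟨
  coeff (scale a q +ₚ scale b q) i                ∎
  where open ≡-Reasoning

scale-* : ∀ b q r → scale b q *ₚ r ≈ scale b (q *ₚ r)
scale-* true  q r = ≈-refl
scale-* false q r = ≈-refl

*-zeroʳ : ∀ p → p *ₚ [] ≈ []
*-zeroʳ []      = ≈-refl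
*-zeroʳ (b ∷ p) = ≈-trans (+-cong (scale-zero b) (∷-cong refl (*-zeroʳ p))) 0∷0≈0

*-congˡ : ∀ p {q q′} → q ≈ q′ → p *ₚ q ≈ p *ₚ q′
*-congˡ []      q≈q′ = ≈-refl
*-congˡ (b ∷ p) q≈q′ = +-cong (scale-cong b q≈q′) (∷-cong refl (*-congˡ p q≈q′))

*-zeroˡ-≈ : ∀ {p} q → p ≈ [] → p *ₚ q ≈ []
*-zeroˡ-≈ {[]}    q p≈0 = ≈-refl
*-zeroˡ-≈ {b ∷ p} q p≈0 with ∷-≈0 p≈0
... | refl , p≈0′ = ≈-trans (∷-cong refl (*-zeroˡ-≈ q p≈0′)) 0∷0≈0

*-congʳ : ∀ {p p′} q → p ≈ p′ → p *ₚ q ≈ p′ *ₚ q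
*-congʳ {[]}    {[]}      q p≈p′ = ≈-refl
*-congʳ {[]}    {b′ ∷ p′} q p≈p′ = ≈-sym (*-zeroˡ-≈ q (≈-sym p≈p′))
*-congʳ {b ∷ p} {[]}      q p≈p′ = *-zeroˡ-≈ q p≈p′
*-congʳ {b ∷ p} {b′ ∷ p′} q p≈p′ with ∷-injective p≈p′
... | refl , p≈p′ = +-congˡ (scale b q) (∷-cong refl (*-congʳ q p≈p′))

*-cong : ∀ {p p′ q q′} → p ≈ p′ → q ≈ q′ → p *ₚ q ≈ p′ *ₚ q′
*-cong {p′ = p′} {q} p≈p′ q≈q′ = ≈-trans (*-congʳ q p≈p′) (*-congˡ p′ q≈q′)

*-distribʳ-+ : ∀ q p p′ → (p +ₚ p′) *ₚ q ≈ p *ₚ q +ₚ p′ *ₚ q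
*-distribʳ-+ q []      p′       = ≈-refl
*-distribʳ-+ q (b ∷ p) []       = ≈-sym (+-identityʳ _)
*-distribʳ-+ q (b ∷ p) (b′ ∷ p′) = begin
  scale (b xor b′) q +ₚ (false ∷ (p +ₚ p′) *ₚ q)
    ≈⟨ +-cong (scale-distrib-xor b b′ q) (∷-cong refl (*-distribʳ-+ q p p′)) ⟩
  (scale b q +ₚ scale b′ q) +ₚ ((false ∷ p *ₚ q) +ₚ (false ∷ p′ *ₚ q))
    ≈⟨ +-interchange (scale b q) (scale b′ q) _ _ ⟩
  (scale b q +ₚ (false ∷ p *ₚ q)) +ₚ (scale b′ q +ₚ (false ∷ p′ *ₚ q)) ∎
  where open ≈-Reasoning

*-consʳ : ∀ q b p → q *ₚ (b ∷ p) ≈ scale b q +ₚ (false ∷ q *ₚ p)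
*-consʳ []      b p = ≈-sym (≈-trans (+-congʳ (false ∷ []) (scale-zero b)) 0∷0≈0)
*-consʳ (a ∷ q) b p = begin
  scale a (b ∷ p) +ₚ (false ∷ q *ₚ (b ∷ p))
    ≈⟨ +-cong (scale-∷ a b p) (∷-cong refl (*-consʳ q b p)) ⟩
  ((a ∧ b) xor false) ∷ (scale a p +ₚ (scale b q +ₚ (false ∷ q *ₚ p)))
    ≈⟨ ∷-cong (cong (_xor false) (∧-comm a b)) (+-left-comm (scale a p) (scale b q) (false ∷ q *ₚ p)) ⟩
  ((b ∧ a) xor false) ∷ (scale b q +ₚ (scale a p +ₚ (false ∷ q *ₚ p)))
    ≈⟨ +-congʳ (false ∷ (a ∷ q) *ₚ p) (scale-∷ b a q) ⟨
  scale b (a ∷ q) +ₚ (false ∷ (a ∷ q) *ₚ p) ∎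
  where open ≈-Reasoning

*-comm : ∀ p q → p *ₚ q ≈ q *ₚ p
*-comm []      q = ≈-sym (*-zeroʳ q)
*-comm (b ∷ p) q = ≈-trans (+-congˡ (scale b q) (∷-cong refl (*-comm p q))) (≈-sym (*-consʳ q b p))

*-assoc : ∀ p q r → (p *ₚ q) *ₚ r ≈ p *ₚ (q *ₚ r)
*-assoc []      q r = ≈-refl
*-assoc (b ∷ p) q r = ≈-trans (*-distribʳ-+ r (scale b q) (false ∷ p *ₚ q))
                              (+-cong (scale-* b q r) (∷-cong refl (*-assoc p q r)))

*-distribˡ-+ : ∀ p q r → p *ₚ (q +ₚ r) ≈ p *ₚ q +ₚ p *ₚ r
*-distribˡ-+ p q r =
  ≈-trans (*-comm p (q +ₚ r)) (≈-trans (*-distribʳ-+ p q r) (+-cong (*-comm q p) (*-comm r p)))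

*-identityˡ : ∀ q → 1ₚ *ₚ q ≈ q
*-identityˡ q = ≈-trans (+-congˡ q 0∷0≈0) (+-identityʳ q)

𝔽₂[x]-isCommutativeRing : IsCommutativeRing _≈_ _+ₚ_ _*ₚ_ id [] 1ₚ
𝔽₂[x]-isCommutativeRing = record
  { isRing = record
    { +-isAbelianGroup = record
      { isGroup = record
        { isMonoid = IsCommutativeMonoid.isMonoid +-isCommutativeMonoid
        ; inverse  = +-self , +-self
        ; ⁻¹-cong  = id
        }
      ; comm = +-comm
      }
    ; *-cong     = *-cong
    ; *-assoc    = *-assoc
    ; *-identity = *-identityˡ , λ q → ≈-trans (*-comm q _) (*-identityˡ q)
    ; distrib    = *-distribˡ-+ , *-distribʳ-+
    }
  ; *-comm = *-comm
  }

𝔽₂[x] : CommutativeRing 0ℓ 0ℓ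
𝔽₂[x] = record { isCommutativeRing = 𝔽₂[x]-isCommutativeRing }

open import Algebra.Properties.CommutativeSemigroup.Divisibility
  (CommutativeRing.*-commutativeSemigroup 𝔽₂[x])
  using (_∣_; _,_; ∣ʳ-trans; ∣ʳ-respˡ-≈; ∣ʳ-respʳ-≈; x∣ʳyx; x∣y∧z∣x/y⇒xz∣y; ∙-cong-∣)
open import Algebra.Properties.Semiring.Divisibility (CommutativeRing.semiring 𝔽₂[x])
  using (_∣0; ε∣ʳ_; ∣ʳ-reflexive)

∣-+ : ∀ {f a b} → f ∣ a → f ∣ b → f ∣ a +ₚ b
∣-+ {f} (q , qf≈a) (r , rf≈b) = q +ₚ r , ≈-trans (*-distribʳ-+ f q r) (+-cong qf≈a rf≈b)

∣-≈0 : ∀ f {a} → a ≈ [] → f ∣ a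
∣-≈0 f a≈0 = ∣ʳ-respʳ-≈ (≈-sym a≈0) (f ∣0)

-- Over 𝔽₂ the difference a − b is a + b.
infix 4 _≡_mod_
record _≡_mod_ (a b f : Poly) : Set where
  constructor ∣-diff
  field divides : f ∣ a +ₚ b

≈⇒≡-mod : ∀ f {a b} → a ≈ b → a ≡ b mod f
≈⇒≡-mod f {a} a≈b = ∣-diff (∣-≈0 f (≈-trans (+-congˡ a (≈-sym a≈b)) (+-self a)))

≡-mod-sym : ∀ {f a b} → a ≡ b mod f → b ≡ a mod f
≡-mod-sym {a = a} {b} (∣-diff f∣a+b) = ∣-diff (∣ʳ-respʳ-≈ (+-comm a b) f∣a+b)

≡-mod-trans : ∀ {f a b c} → a ≡ b mod f → b ≡ c mod f → a ≡ c mod f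
≡-mod-trans {a = a} {b} {c} (∣-diff f∣a+b) (∣-diff f∣b+c) =
  ∣-diff (∣ʳ-respʳ-≈ (≈-trans (+-assoc a b (b +ₚ c)) (+-congˡ a (+-cancelˡ b c))) (∣-+ f∣a+b f∣b+c))

≡-mod-*ˡ : ∀ {f a b} c → a ≡ b mod f → c *ₚ a ≡ c *ₚ b mod f
≡-mod-*ˡ {f} {a} {b} c (∣-diff (q , qf≈a+b)) = ∣-diff (c *ₚ q , (begin
  (c *ₚ q) *ₚ f    ≈⟨ *-assoc c q f ⟩
  c *ₚ (q *ₚ f)    ≈⟨ *-congˡ c qf≈a+b ⟩
  c *ₚ (a +ₚ b)    ≈⟨ *-distribˡ-+ c a b ⟩
  c *ₚ a +ₚ c *ₚ b ∎))
  where open ≈-Reasoning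

≡-mod-*ʳ : ∀ {f a b} c → a ≡ b mod f → a *ₚ c ≡ b *ₚ c mod f
≡-mod-*ʳ {a = a} {b} c a≡b with ≡-mod-*ˡ c a≡b
... | ∣-diff f∣ca+cb = ∣-diff (∣ʳ-respʳ-≈ (+-cong (*-comm c a) (*-comm c b)) f∣ca+cb)

record Unit (f g : Poly) : Set where
  constructor _,_
  field
    inverse   : Poly
    inverse-≡ : g *ₚ inverse ≡ 1ₚ mod f

Unit-cong : ∀ {f a b} → a ≡ b mod f → Unit f a ⇔ Unit f b
Unit-cong a≡b = mk⇔ (resp a≡b) (resp (≡-mod-sym a≡b))
  where
  resp : ∀ {f a b} → a ≡ b mod f → Unit f a → Unit f b
  resp a≡b (u , au≡1) = u , ≡-mod-trans (≡-mod-sym (≡-mod-*ʳ u a≡b)) au≡1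

Unit-∣ : ∀ {f f′ g} → f ∣ f′ → Unit f′ g → Unit f g
Unit-∣ f∣f′ (u , ∣-diff f′∣gu+1) = u , ∣-diff (∣ʳ-trans f∣f′ f′∣gu+1)

-- Evaluation at c ∈ 𝔽₂ and the factors x + c

ev : Bool → Poly → Bool
ev c []      = false
ev c (b ∷ p) = b xor (c ∧ ev c p)

open CommutativeSemigroupProperties (CommutativeRing.+-commutativeSemigroup xor-∧-commutativeRing)
  using () renaming (interchange to xor-interchange)

xor-cancelˡ : ∀ x y → x xor (x xor y) ≡ y
xor-cancelˡ x y = trans (sym (xor-assoc x x y)) (cong (_xor y) (xor-same x))

xor≡1⇒≡not : ∀ {a b} → a xor b ≡ true → a ≡ not b
xor≡1⇒≡not {false} {true}  _ = refl
xor≡1⇒≡not {true}  {false} _ = refl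

ev-≈0 : ∀ c {p} → p ≈ [] → ev c p ≡ false
ev-≈0 c {[]}    p≈0 = refl
ev-≈0 c {b ∷ p} p≈0 with ∷-≈0 p≈0
... | refl , p≈0′ = trans (cong (c ∧_) (ev-≈0 c p≈0′)) (∧-zeroʳ c)

ev-cong : ∀ c {p q} → p ≈ q → ev c p ≡ ev c q
ev-cong c {[]}    {[]}    p≈q = refl
ev-cong c {[]}    {b ∷ q} p≈q = sym (ev-≈0 c (≈-sym p≈q))
ev-cong c {a ∷ p} {[]}    p≈q = ev-≈0 c p≈q
ev-cong c {a ∷ p} {b ∷ q} p≈q with ∷-injective p≈q
... | refl , p≈q′ = cong (λ e → a xor (c ∧ e)) (ev-cong c p≈q′)

ev-+ : ∀ c p q → ev c (p +ₚ q) ≡ ev c p xor ev c q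
ev-+ c []      q       = refl
ev-+ c (a ∷ p) []      = sym (xor-identityʳ _)
ev-+ c (a ∷ p) (b ∷ q) = begin
  (a xor b) xor (c ∧ ev c (p +ₚ q))                    ≡⟨ cong (λ e → (a xor b) xor (c ∧ e)) (ev-+ c p q) ⟩
  (a xor b) xor (c ∧ (ev c p xor ev c q))              ≡⟨ cong ((a xor b) xor_) (∧-distribˡ-xor c (ev c p) (ev c q)) ⟩
  (a xor b) xor ((c ∧ ev c p) xor (c ∧ ev c q))        ≡⟨ xor-interchange a b (c ∧ ev c p) (c ∧ ev c q) ⟩
  (a xor (c ∧ ev c p)) xor (b xor (c ∧ ev c q))        ∎
  where open ≡-Reasoning

ev-scale : ∀ c b q → ev c (scale b q) ≡ b ∧ ev c q
ev-scale c true  q = refl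
ev-scale c false q = refl

ev-* : ∀ c p q → ev c (p *ₚ q) ≡ ev c p ∧ ev c q
ev-* c []      q = refl
ev-* c (b ∷ p) q = begin
  ev c (scale b q +ₚ (false ∷ p *ₚ q))             ≡⟨ ev-+ c (scale b q) (false ∷ p *ₚ q) ⟩
  ev c (scale b q) xor (c ∧ ev c (p *ₚ q))         ≡⟨ cong₂ (λ x y → x xor (c ∧ y)) (ev-scale c b q) (ev-* c p q) ⟩
  (b ∧ ev c q) xor (c ∧ (ev c p ∧ ev c q))         ≡⟨ cong ((b ∧ ev c q) xor_) (∧-assoc c (ev c p) (ev c q)) ⟨
  (b ∧ ev c q) xor ((c ∧ ev c p) ∧ ev c q)         ≡⟨ ∧-distribʳ-xor (ev c q) b (c ∧ ev c p) ⟨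
  (b xor (c ∧ ev c p)) ∧ ev c q                    ∎
  where open ≡-Reasoning

ev-1 : ∀ c → ev c 1ₚ ≡ true
ev-1 c = cong (true xor_) (∧-zeroʳ c)

ev-∣ : ∀ c {p q} → p ∣ q → ev c p ≡ false → ev c q ≡ false
ev-∣ c {p} {q} (r , rp≈q) evp≡0 = begin
  ev c q            ≡⟨ ev-cong c rp≈q ⟨
  ev c (r *ₚ p)     ≡⟨ ev-* c r p ⟩
  ev c r ∧ ev c p   ≡⟨ cong (ev c r ∧_) evp≡0 ⟩
  ev c r ∧ false    ≡⟨ ∧-zeroʳ (ev c r) ⟩
  false             ∎
  where open ≡-Reasoning

infix 9 x+_
x+_ : Bool → Poly
x+ c = c ∷ true ∷ []

ev-x+ : ∀ c → ev c (x+ c) ≡ false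
ev-x+ false = refl
ev-x+ true  = refl

ev-x+-not : ∀ c → ev (not c) (x+ c) ≡ true
ev-x+-not false = refl
ev-x+-not true  = refl

remainder : ∀ c m → ∃[ q ] m ≈ q *ₚ x+ c +ₚ (ev c m ∷ [])
remainder c []      = [] , ≈-sym 0∷0≈0
remainder c (b ∷ m) with remainder c m
... | q , m≈qx+r = ev c m ∷ q , ≈-sym (begin
  (scale e (x+ c) +ₚ (false ∷ q *ₚ x+ c)) +ₚ (b′ ∷ [])
    ≈⟨ +-congʳ (b′ ∷ []) (+-congʳ (false ∷ q *ₚ x+ c) (scale-∷ e c 1ₚ)) ⟩
  (((e ∧ c) xor false) xor b′) ∷ ((scale e 1ₚ +ₚ q *ₚ x+ c) +ₚ [])
    ≈⟨ ∷-cong head (≈-trans (+-identityʳ _) (≈-trans (+-congʳ (q *ₚ x+ c) (scale-1 e)) (+-comm (e ∷ []) (q *ₚ x+ c)))) ⟩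
  b ∷ (q *ₚ x+ c +ₚ (e ∷ []))
    ≈⟨ ∷-cong refl (≈-sym m≈qx+r) ⟩
  b ∷ m ∎)
  where
  open ≈-Reasoning
  e = ev c m
  b′ = b xor (c ∧ e)
  scale-1 : ∀ e → scale e 1ₚ ≈ e ∷ []
  scale-1 true  = ≈-refl
  scale-1 false = ≈-sym 0∷0≈0
  head : ((e ∧ c) xor false) xor (b xor (c ∧ e)) ≡ b
  head = trans (cong₂ (λ x y → x xor (b xor y)) (xor-identityʳ (e ∧ c)) (∧-comm c e))
               (trans (cong ((e ∧ c) xor_) (xor-comm b (e ∧ c))) (xor-cancelˡ (e ∧ c) b))

factor : ∀ c {m} → ev c m ≡ false → x+ c ∣ m
factor c {m} evm≡0 with remainder c m
... | q , m≈qx+r = q , ≈-sym (begin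
  m                            ≈⟨ m≈qx+r ⟩
  q *ₚ x+ c +ₚ (ev c m ∷ [])   ≈⟨ +-congˡ (q *ₚ x+ c) (≈-trans (∷-cong evm≡0 ≈-refl) 0∷0≈0) ⟩
  q *ₚ x+ c +ₚ []              ≈⟨ +-identityʳ (q *ₚ x+ c) ⟩
  q *ₚ x+ c                    ∎)
  where open ≈-Reasoning

square-+ : ∀ p q → (p +ₚ q) *ₚ (p +ₚ q) ≈ p *ₚ p +ₚ q *ₚ q
square-+ p q = begin
  (p +ₚ q) *ₚ (p +ₚ q)
    ≈⟨ *-distribʳ-+ (p +ₚ q) p q ⟩
  p *ₚ (p +ₚ q) +ₚ q *ₚ (p +ₚ q)
    ≈⟨ +-cong (*-distribˡ-+ p p q) (*-distribˡ-+ q p q) ⟩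
  (p *ₚ p +ₚ p *ₚ q) +ₚ (q *ₚ p +ₚ q *ₚ q)
    ≈⟨ +-congˡ (p *ₚ p +ₚ p *ₚ q) (+-comm (q *ₚ p) (q *ₚ q)) ⟩
  (p *ₚ p +ₚ p *ₚ q) +ₚ (q *ₚ q +ₚ q *ₚ p)
    ≈⟨ +-interchange (p *ₚ p) (p *ₚ q) (q *ₚ q) (q *ₚ p) ⟩
  (p *ₚ p +ₚ q *ₚ q) +ₚ (p *ₚ q +ₚ q *ₚ p)
    ≈⟨ +-congˡ (p *ₚ p +ₚ q *ₚ q) (≈-trans (+-congˡ (p *ₚ q) (*-comm q p)) (+-self (p *ₚ q))) ⟩
  (p *ₚ p +ₚ q *ₚ q) +ₚ []
    ≈⟨ +-identityʳ _ ⟩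
  p *ₚ p +ₚ q *ₚ q
    ∎
  where open ≈-Reasoning

∣-coprime-root : ∀ c {h k} → ev c h ≡ true → h ∣ k → ev c k ≡ false → x+ c *ₚ h ∣ k
∣-coprime-root c {h} {k} evh≡1 h∣k@(m , mh≈k) evk≡0 =
  ∣ʳ-respˡ-≈ (*-comm h (x+ c)) (x∣y∧z∣x/y⇒xz∣y h∣k (factor c evm≡0))
  where
  evm≡0 : ev c m ≡ false
  evm≡0 = begin
    ev c m            ≡⟨ ∧-identityʳ (ev c m) ⟨
    ev c m ∧ true     ≡⟨ cong (ev c m ∧_) evh≡1 ⟨
    ev c m ∧ ev c h   ≡⟨ ev-* c m h ⟨
    ev c (m *ₚ h)     ≡⟨ ev-cong c mh≈k ⟩
    ev c k            ≡⟨ evk≡0 ⟩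
    false             ∎
    where open ≡-Reasoning

Unit⇒ev≡1 : ∀ c {f g} → ev c f ≡ false → Unit f g → ev c g ≡ true
Unit⇒ev≡1 c {g = g} evf≡0 (u , ∣-diff f∣gu+1) =
  invertible (trans (cong (_xor ev c 1ₚ) (sym (ev-* c g u))) (trans (sym (ev-+ c (g *ₚ u) 1ₚ)) (ev-∣ c f∣gu+1 evf≡0)))
  where
  invertible : ∀ {a b} → (a ∧ b) xor ev c 1ₚ ≡ false → a ≡ true
  invertible {true}  _ = refl
  invertible {false} e = contradiction (trans (sym (ev-1 c)) e) λ ()

ev-x+* : ∀ c h → ev c (x+ c *ₚ h) ≡ false
ev-x+* c h = trans (ev-* c (x+ c) h) (cong (_∧ ev c h) (ev-x+ c))

Unit-x+*-root : ∀ c {h g} → ev c h ≡ false → Unit (x+ c *ₚ h) g ⇔ Unit h g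
Unit-x+*-root c {h} {g} evh≡0 = mk⇔ (Unit-∣ (x∣ʳyx h (x+ c))) lift
  where
  -- g u ≡ 1 mod h gives (g u)² ≡ 1 mod h², and x + c ∣ h
  lift : Unit h g → Unit (x+ c *ₚ h) g
  lift (u , ∣-diff h∣gu+1) =
    u *ₚ (g *ₚ u) , ∣-diff (
    ∣ʳ-respʳ-≈ (≈-trans (square-+ (g *ₚ u) 1ₚ) (+-congʳ 1ₚ (*-assoc g u (g *ₚ u))))
               (∙-cong-∣ (∣ʳ-trans (factor c evh≡0) h∣gu+1) h∣gu+1))

Unit-x+*-coprime : ∀ c {h g} → ev c h ≡ true → Unit (x+ c *ₚ h) g ⇔ (Unit h g × ev c g ≡ true)
Unit-x+*-coprime c {h} {g} evh≡1 =
  mk⇔ (λ unit → Unit-∣ (x∣ʳyx h (x+ c)) unit , Unit⇒ev≡1 c (ev-x+* c h) unit) lift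
  where
  lift : Unit h g × ev c g ≡ true → Unit (x+ c *ₚ h) g
  lift ((u , ∣-diff h∣gu+1) , evg≡1) = u′ , ∣-diff (∣-coprime-root c evh≡1 h∣gu′+1 evgu′+1≡0)
    where
    -- u′ ≡ u mod h, corrected so that u′(c) = 1
    u′ = u +ₚ (u +ₚ 1ₚ) *ₚ h
    h∣gu′+1 : h ∣ g *ₚ u′ +ₚ 1ₚ
    h∣gu′+1 = ∣ʳ-respʳ-≈ (≈-sym (begin
      g *ₚ u′ +ₚ 1ₚ                                    ≈⟨ +-congʳ 1ₚ (*-distribˡ-+ g u ((u +ₚ 1ₚ) *ₚ h)) ⟩
      (g *ₚ u +ₚ g *ₚ ((u +ₚ 1ₚ) *ₚ h)) +ₚ 1ₚ          ≈⟨ +-right-comm (g *ₚ u) (g *ₚ ((u +ₚ 1ₚ) *ₚ h)) 1ₚ ⟩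
      (g *ₚ u +ₚ 1ₚ) +ₚ g *ₚ ((u +ₚ 1ₚ) *ₚ h)          ≈⟨ +-congˡ (g *ₚ u +ₚ 1ₚ) (*-assoc g (u +ₚ 1ₚ) h) ⟨
      (g *ₚ u +ₚ 1ₚ) +ₚ (g *ₚ (u +ₚ 1ₚ)) *ₚ h          ∎))
      (∣-+ h∣gu+1 (x∣ʳyx h (g *ₚ (u +ₚ 1ₚ))))
      where open ≈-Reasoning
    evu′≡1 : ev c u′ ≡ true
    evu′≡1 = begin
      ev c u′                                               ≡⟨ ev-+ c u ((u +ₚ 1ₚ) *ₚ h) ⟩
      ev c u xor ev c ((u +ₚ 1ₚ) *ₚ h)                      ≡⟨ cong (ev c u xor_) (ev-* c (u +ₚ 1ₚ) h) ⟩
      ev c u xor (ev c (u +ₚ 1ₚ) ∧ ev c h)                  ≡⟨ cong (λ e → ev c u xor (ev c (u +ₚ 1ₚ) ∧ e)) evh≡1 ⟩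
      ev c u xor (ev c (u +ₚ 1ₚ) ∧ true)                    ≡⟨ cong (ev c u xor_) (∧-identityʳ _) ⟩
      ev c u xor ev c (u +ₚ 1ₚ)                             ≡⟨ cong (ev c u xor_) (ev-+ c u 1ₚ) ⟩
      ev c u xor (ev c u xor ev c 1ₚ)                       ≡⟨ xor-cancelˡ (ev c u) (ev c 1ₚ) ⟩
      ev c 1ₚ                                               ≡⟨ ev-1 c ⟩
      true                                                  ∎
      where open ≡-Reasoning
    evgu′+1≡0 : ev c (g *ₚ u′ +ₚ 1ₚ) ≡ false
    evgu′+1≡0 = begin
      ev c (g *ₚ u′ +ₚ 1ₚ)               ≡⟨ ev-+ c (g *ₚ u′) 1ₚ ⟩
      ev c (g *ₚ u′) xor ev c 1ₚ         ≡⟨ cong₂ _xor_ (ev-* c g u′) (ev-1 c) ⟩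
      (ev c g ∧ ev c u′) xor true        ≡⟨ cong₂ (λ a b → (a ∧ b) xor true) evg≡1 evu′≡1 ⟩
      false                              ∎
      where open ≡-Reasoning

-- Over 𝔽₂ the normal nonzero polynomials are exactly the lists ending in 1, all of them monic.
NormalMonic : Poly → Set
NormalMonic f = ∃[ L ] f ≡ L ∷ʳ true

coeff-∷ʳ : ∀ L b → coeff (L ∷ʳ b) (length L) ≡ b
coeff-∷ʳ []      b = refl
coeff-∷ʳ (_ ∷ L) b = coeff-∷ʳ L b

coeff-beyond : ∀ p {i} → length p ≤ i → coeff p i ≡ false
coeff-beyond []      _         = refl
coeff-beyond (_ ∷ p) (s≤s p≤i) = coeff-beyond p p≤i

∷ʳ1-≉0 : ∀ L → ¬ L ∷ʳ true ≈ []
∷ʳ1-≉0 L L∷ʳ1≈0 = contradiction (trans (sym (coeff-∷ʳ L true)) (coeff-≡ L∷ʳ1≈0 (length L))) λ ()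

∷ʳ1-injective : ∀ L M → L ∷ʳ true ≈ M ∷ʳ true → L ≡ M
∷ʳ1-injective []      []      _ = refl
∷ʳ1-injective []      (m ∷ M) e = contradiction (≈-sym (proj₂ (∷-injective e))) (∷ʳ1-≉0 M)
∷ʳ1-injective (l ∷ L) []      e = contradiction (proj₂ (∷-injective e)) (∷ʳ1-≉0 L)
∷ʳ1-injective (l ∷ L) (m ∷ M) e with ∷-injective e
... | l≡m , e′ = cong₂ _∷_ l≡m (∷ʳ1-injective L M e′)

normalMonic-≈⇒≡ : ∀ {f g} → NormalMonic f → NormalMonic g → f ≈ g → f ≡ g
normalMonic-≈⇒≡ (L , refl) (M , refl) f≈g = cong (_∷ʳ true) (∷ʳ1-injective L M f≈g)

normalize-≈ : ∀ p → normalize p ≈ p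
normalize-≈ []      = ≈-refl
normalize-≈ (b ∷ p) with normalize p | normalize-≈ p
... | []    | 0≈p = trailing b
  where
  trailing : ∀ b → (if b then b ∷ [] else []) ≈ b ∷ p
  trailing true  = ∷-cong refl 0≈p
  trailing false = ≈-sym (≈-trans (∷-cong refl (≈-sym 0≈p)) 0∷0≈0)
... | _ ∷ _ | q≈p = ∷-cong refl q≈p

normalize-view : ∀ p → normalize p ≡ [] ⊎ NormalMonic (normalize p)
normalize-view []      = inj₁ refl
normalize-view (b ∷ p) with normalize p | normalize-view p
... | []    | _                = trailing b
  where
  trailing : ∀ b → (if b then b ∷ [] else []) ≡ [] ⊎ NormalMonic (if b then b ∷ [] else [])
  trailing true  = inj₂ ([] , refl)
  trailing false = inj₁ refl
... | _ ∷ _ | inj₂ (L , q≡L∷ʳ1) = inj₂ (b ∷ L , cong (b ∷_) q≡L∷ʳ1)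

≈0-or-normalMonic : ∀ p → p ≈ [] ⊎ ∃[ q ] NormalMonic q × q ≈ p
≈0-or-normalMonic p with normalize-view p
... | inj₁ np≡0 = inj₁ (≈-trans (≈-sym (normalize-≈ p)) (≈-reflexive np≡0))
... | inj₂ nm   = inj₂ (normalize p , nm , normalize-≈ p)

normalize-∷ʳ1 : ∀ L → normalize (L ∷ʳ true) ≡ L ∷ʳ true
normalize-∷ʳ1 []      = refl
normalize-∷ʳ1 (b ∷ L) rewrite normalize-∷ʳ1 L with L
... | []    = refl
... | _ ∷ _ = refl

lead-∷ʳ1 : ∀ L → lead (L ∷ʳ true) ≡ true
lead-∷ʳ1 []          = refl
lead-∷ʳ1 (_ ∷ [])    = refl
lead-∷ʳ1 (_ ∷ l ∷ L) = lead-∷ʳ1 (l ∷ L)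

deg-∷ʳ1 : ∀ L → deg (L ∷ʳ true) ≡ length L
deg-∷ʳ1 L = begin
  length (normalize (L ∷ʳ true)) ∸ 1   ≡⟨ cong (λ p → length p ∸ 1) (normalize-∷ʳ1 L) ⟩
  length (L ∷ʳ true) ∸ 1               ≡⟨ cong (_∸ 1) (length-++ L) ⟩
  length L + 1 ∸ 1                     ≡⟨ ℕ.m+n∸n≡m (length L) 1 ⟩
  length L                             ∎
  where open ≡-Reasoning

take-length-++ : ∀ (L M : List Bool) → take (length L) (L ++ M) ≡ L
take-length-++ []      M = refl
take-length-++ (l ∷ L) M = cong (l ∷_) (take-length-++ L M)

lowPart-∷ʳ1 : ∀ L → lowPart (L ∷ʳ true) ≡ L
lowPart-∷ʳ1 L rewrite deg-∷ʳ1 L | normalize-∷ʳ1 L = take-length-++ L (true ∷ [])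

+ₚ-identityʳ : ∀ p → p +ₚ [] ≡ p
+ₚ-identityʳ []      = refl
+ₚ-identityʳ (_ ∷ _) = refl

length-+ₚ : ∀ p q → length p ≤ length q → length (p +ₚ q) ≡ length q
length-+ₚ []      q       _         = refl
length-+ₚ (a ∷ p) (b ∷ q) (s≤s p≤q) = cong suc (length-+ₚ p q p≤q)

+ₚ-∷ʳ : ∀ p q b → length p ≤ length q → p +ₚ (q ∷ʳ b) ≡ (p +ₚ q) ∷ʳ b
+ₚ-∷ʳ []      q       b _         = refl
+ₚ-∷ʳ (a ∷ p) (c ∷ q) b (s≤s p≤q) = cong ((a xor c) ∷_) (+ₚ-∷ʳ p q b p≤q)

length-scale : ∀ b q → length (scale b q) ≤ length q
length-scale true  q = ℕ.≤-refl
length-scale false q = z≤n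

*-∷ʳ1 : ∀ L M → ∃[ N ] (L ∷ʳ true) *ₚ (M ∷ʳ true) ≡ N ∷ʳ true × length N ≡ length L + length M
*-∷ʳ1 []      []      = [] , refl , refl
*-∷ʳ1 []      (m ∷ M) = m ∷ M , cong₂ _∷_ (xor-identityʳ m) (+ₚ-identityʳ (M ∷ʳ true)) , refl
*-∷ʳ1 (l ∷ L) M with *-∷ʳ1 L M
... | N , LM≡N∷ʳ1 , |N| = scale l q +ₚ (false ∷ N) , product , length-sum
  where
  q = M ∷ʳ true
  |q|≤|0∷N| : length (scale l q) ≤ length (false ∷ N)
  |q|≤|0∷N| = ℕ.≤-trans (length-scale l q) (begin
    length (M ∷ʳ true)        ≡⟨ length-++ M ⟩
    length M + 1              ≡⟨ ℕ.+-comm (length M) 1 ⟩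
    suc (length M)            ≤⟨ s≤s (ℕ.m≤n+m (length M) (length L)) ⟩
    suc (length L + length M) ≡⟨ cong suc |N| ⟨
    length (false ∷ N)        ∎)
    where open ℕ.≤-Reasoning
  product : scale l q +ₚ (false ∷ (L ∷ʳ true) *ₚ q) ≡ (scale l q +ₚ (false ∷ N)) ∷ʳ true
  product = trans (cong (λ r → scale l q +ₚ (false ∷ r)) LM≡N∷ʳ1) (+ₚ-∷ʳ (scale l q) (false ∷ N) true |q|≤|0∷N|)
  length-sum : length (scale l q +ₚ (false ∷ N)) ≡ suc (length L + length M)
  length-sum = trans (length-+ₚ (scale l q) (false ∷ N) |q|≤|0∷N|) (cong suc |N|)

x+*-normalMonic : ∀ c {h} → NormalMonic h → NormalMonic (x+ c *ₚ h)
x+*-normalMonic c (L , refl) = proj₁ (*-∷ʳ1 (c ∷ []) L) , proj₁ (proj₂ (*-∷ʳ1 (c ∷ []) L))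

length-x+* : ∀ c {h} → NormalMonic h → length (x+ c *ₚ h) ≡ suc (length h)
length-x+* c (L , refl) with *-∷ʳ1 (c ∷ []) L
... | N , x+cL≡N∷ʳ1 , |N| = begin
  length (x+ c *ₚ (L ∷ʳ true))  ≡⟨ cong length x+cL≡N∷ʳ1 ⟩
  length (N ∷ʳ true)            ≡⟨ length-++ N ⟩
  length N + 1                  ≡⟨ cong (_+ 1) |N| ⟩
  suc (length L) + 1            ≡⟨ cong suc (length-++ L) ⟨
  suc (length (L ∷ʳ true))      ∎
  where open ≡-Reasoning

∣-short⇒≈0 : ∀ {f t} → NormalMonic f → f ∣ t → length t ≤ deg f → t ≈ []
∣-short⇒≈0 {f} f-nm (q , qf≈t) |t|≤d with ≈0-or-normalMonic q
... | inj₁ q≈0 = ≈-trans (≈-sym qf≈t) (*-zeroˡ-≈ f q≈0)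
∣-short⇒≈0 {t = t} (L , refl) (q , qf≈t) |t|≤d | inj₂ (_ , (M , refl) , q′≈q) with *-∷ʳ1 M L
... | N , q′f≡N∷ʳ1 , |N| = contradiction leading-coeff λ ()
  where
  N∷ʳ1≈t : N ∷ʳ true ≈ t
  N∷ʳ1≈t = ≈-trans (≈-reflexive (sym q′f≡N∷ʳ1)) (≈-trans (*-congʳ (L ∷ʳ true) q′≈q) qf≈t)
  |t|≤|N| : length t ≤ length N
  |t|≤|N| = begin
    length t                ≤⟨ |t|≤d ⟩
    deg (L ∷ʳ true)         ≡⟨ deg-∷ʳ1 L ⟩
    length L                ≤⟨ ℕ.m≤n+m (length L) (length M) ⟩
    length M + length L     ≡⟨ |N| ⟨
    length N                ∎
    where open ℕ.≤-Reasoning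
  leading-coeff : true ≡ false
  leading-coeff = trans (sym (coeff-∷ʳ N true)) (trans (coeff-≡ N∷ʳ1≈t (length N)) (coeff-beyond t |t|≤|N|))

-- Residues modulo a normal monic polynomial

∷-≡-mod : ∀ {f a b} c → a ≡ b mod f → c ∷ a ≡ c ∷ b mod f
∷-≡-mod c (∣-diff (q , qf≈a+b)) = ∣-diff (false ∷ q , ∷-cong (sym (xor-same c)) qf≈a+b)

replicate-false-≈0 : ∀ n → replicate n false ≈ []
replicate-false-≈0 zero    = ≈-refl
replicate-false-≈0 (suc n) = ≈-trans (∷-cong refl (replicate-false-≈0 n)) 0∷0≈0

+≈0⇒≈ : ∀ {p q} → p +ₚ q ≈ [] → p ≈ q
+≈0⇒≈ {p} {q} p+q≈0 = ≈-trans (≈-sym (+-cancelˡ q p)) (≈-trans (+-congˡ q (≈-trans (+-comm q p) p+q≈0)) (+-identityʳ q))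

≈-length⇒≡ : ∀ {p q} → length p ≡ length q → p ≈ q → p ≡ q
≈-length⇒≡ {[]}    {[]}    _       _   = refl
≈-length⇒≡ {a ∷ p} {b ∷ q} |p|≡|q| p≈q with ∷-injective p≈q
... | a≡b , p≈q′ = cong₂ _∷_ a≡b (≈-length⇒≡ (ℕ.suc-injective |p|≡|q|) p≈q′)

∷ʳ-+ₚ-cancel : ∀ s L b → length s ≡ length L → (s ∷ʳ b) +ₚ (s +ₚ L) ≡ L ∷ʳ b
∷ʳ-+ₚ-cancel []      []      b _     = refl
∷ʳ-+ₚ-cancel (a ∷ s) (l ∷ L) b |s|≡|L| =
  cong₂ _∷_ (xor-cancelˡ a l) (∷ʳ-+ₚ-cancel s L b (ℕ.suc-injective |s|≡|L|))

∷ʳ0-≈ : ∀ s → s ∷ʳ false ≈ s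
∷ʳ0-≈ []      = 0∷0≈0
∷ʳ0-≈ (a ∷ s) = ∷-cong refl (∷ʳ0-≈ s)

take-∷ʳ-last : ∀ c r₀ r → take (suc (length r)) (c ∷ r₀ ∷ r) ∷ʳ lastOr r₀ r ≡ c ∷ r₀ ∷ r
take-∷ʳ-last c r₀ []       = refl
take-∷ʳ-last c r₀ (r₁ ∷ r) = cong (c ∷_) (take-∷ʳ-last r₀ r₁ r)

∈-allBits : ∀ r → r ∈ allBits (length r)
∈-allBits []          = here refl
∈-allBits (false ∷ r) = ∈-++⁺ˡ (∈-map⁺ (false ∷_) (∈-allBits r))
∈-allBits (true ∷ r)  = ∈-++⁺ʳ (map (false ∷_) (allBits (length r))) (∈-map⁺ (true ∷_) (∈-allBits r))

eqᵇ-sound : ∀ p q → T (eqᵇ p q) → p ≡ q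
eqᵇ-sound []          []          _ = refl
eqᵇ-sound (true ∷ p)  (true ∷ q)  e = cong (true ∷_) (eqᵇ-sound p q e)
eqᵇ-sound (false ∷ p) (false ∷ q) e = cong (false ∷_) (eqᵇ-sound p q e)

eqᵇ-refl : ∀ p → T (eqᵇ p p)
eqᵇ-refl []          = _
eqᵇ-refl (true ∷ p)  = eqᵇ-refl p
eqᵇ-refl (false ∷ p) = eqᵇ-refl p

module Residues {f : Poly} (f-nm : NormalMonic f) where

  private
    L = lowPart f
    d = deg f

    M = proj₁ f-nm

    L≡M : L ≡ M
    L≡M = trans (cong lowPart (proj₂ f-nm)) (lowPart-∷ʳ1 M)

    f≡L∷ʳ1 : f ≡ L ∷ʳ true
    f≡L∷ʳ1 = trans (proj₂ f-nm) (cong (_∷ʳ true) (sym L≡M))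

  lowPart-length : length L ≡ d
  lowPart-length = trans (cong length L≡M) (sym (trans (cong deg (proj₂ f-nm)) (deg-∷ʳ1 M)))

  ∷ʳ1-+-lowPart : ∀ s → length s ≡ d → (s ∷ʳ true) +ₚ (s +ₚ L) ≡ f
  ∷ʳ1-+-lowPart s |s|≡d = trans (∷ʳ-+ₚ-cancel s L true (trans |s|≡d (sym lowPart-length))) (sym f≡L∷ʳ1)

  -- s ∷ʳ b is s + b xᵈ, and xᵈ ≡ L because f = L + xᵈ.
  ∷ʳ-≡-mod : ∀ b s → length s ≡ d → s ∷ʳ b ≡ (if b then s +ₚ L else s) mod f
  ∷ʳ-≡-mod true  s |s|≡d = ∣-diff (∣ʳ-reflexive (≈-reflexive (sym (∷ʳ1-+-lowPart s |s|≡d))))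
  ∷ʳ-≡-mod false s |s|≡d = ≈⇒≡-mod f (∷ʳ0-≈ s)

  private
    everything-≡-mod : d ≡ 0 → ∀ a b → a ≡ b mod f
    everything-≡-mod d≡0 a b =
      ∣-diff (∣ʳ-respˡ-≈ (≈-reflexive (sym (trans f≡L∷ʳ1 (degree-0 L (trans lowPart-length d≡0))))) (ε∣ʳ (a +ₚ b)))
      where
      degree-0 : ∀ L → length L ≡ 0 → L ∷ʳ true ≡ 1ₚ
      degree-0 [] _ = refl

    length-take-∷ : ∀ c (r : List Bool) → length r ≡ d → length (take d (c ∷ r)) ≡ d
    length-take-∷ c r |r|≡d =
      trans (length-take d (c ∷ r)) (ℕ.m≤n⇒m⊓n≡m (ℕ.≤-trans (ℕ.≤-reflexive (sym |r|≡d)) (ℕ.n≤1+n _)))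

  step-≡ : ∀ c r → length r ≡ d → step f c r ≡ c ∷ r mod f
  step-≡ c []       0≡d  = everything-≡-mod (sym 0≡d) _ _
  step-≡ c (r₀ ∷ r) |r|≡d =
    ≡-mod-trans (≡-mod-sym (∷ʳ-≡-mod (lastOr r₀ r) body |body|≡d)) (≈⇒≡-mod f (≈-reflexive split))
    where
    body = take d (c ∷ r₀ ∷ r)
    |body|≡d : length body ≡ d
    |body|≡d = length-take-∷ c (r₀ ∷ r) |r|≡d
    split : body ∷ʳ lastOr r₀ r ≡ c ∷ r₀ ∷ r
    split = subst (λ k → take k (c ∷ r₀ ∷ r) ∷ʳ lastOr r₀ r ≡ c ∷ r₀ ∷ r) |r|≡d (take-∷ʳ-last c r₀ r)

  length-step : ∀ c r → length r ≡ d → length (step f c r) ≡ d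
  length-step c r |r|≡d = length-if (lastOr false r) (length-take-∷ c r |r|≡d)
    where
    length-if : ∀ b {s} → length s ≡ d → length (if b then s +ₚ L else s) ≡ d
    length-if true  {s} |s|≡d = trans (length-+ₚ s L (ℕ.≤-reflexive (trans |s|≡d (sym lowPart-length)))) lowPart-length
    length-if false     |s|≡d = |s|≡d

  length-modₚ : ∀ g → length (modₚ f g) ≡ d
  length-modₚ []      = length-replicate d
  length-modₚ (c ∷ g) = length-step c (modₚ f g) (length-modₚ g)

  modₚ-≡ : ∀ g → modₚ f g ≡ g mod f
  modₚ-≡ []      = ≈⇒≡-mod f (replicate-false-≈0 d)
  modₚ-≡ (c ∷ g) = ≡-mod-trans (step-≡ c (modₚ f g) (length-modₚ g)) (∷-≡-mod c (modₚ-≡ g))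

  residue-unique : ∀ {r s} → length r ≡ d → length s ≡ d → r ≡ s mod f → r ≡ s
  residue-unique {r} {s} |r|≡d |s|≡d (∣-diff f∣r+s) =
    ≈-length⇒≡ (trans |r|≡d (sym |s|≡d)) (+≈0⇒≈ (∣-short⇒≈0 f-nm f∣r+s |r+s|≤d))
    where
    |r+s|≤d : length (r +ₚ s) ≤ d
    |r+s|≤d = ℕ.≤-reflexive (trans (length-+ₚ r s (ℕ.≤-reflexive (trans |r|≡d (sym |s|≡d)))) |s|≡d)

  ≡-mod⇒modₚ-≡ : ∀ {a b} → a ≡ b mod f → modₚ f a ≡ modₚ f b
  ≡-mod⇒modₚ-≡ {a} {b} a≡b = residue-unique (length-modₚ a) (length-modₚ b)
    (≡-mod-trans (modₚ-≡ a) (≡-mod-trans a≡b (≡-mod-sym (modₚ-≡ b))))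

  modₚ-≡⇒≡-mod : ∀ {a b} → modₚ f a ≡ modₚ f b → a ≡ b mod f
  modₚ-≡⇒≡-mod {a} {b} ma≡mb =
    ≡-mod-trans (≡-mod-sym (modₚ-≡ a)) (subst (_≡ b mod f) (sym ma≡mb) (modₚ-≡ b))

  isUnitᵇ⇔Unit : ∀ g → T (isUnitᵇ f g) ⇔ Unit f g
  isUnitᵇ⇔Unit g = mk⇔ sound complete
    where
    inverts : Poly → Bool
    inverts h = eqᵇ (mulMod f g h) (modₚ f 1ₚ)
    sound : T (isUnitᵇ f g) → Unit f g
    sound t with satisfied (any⁻ inverts (allBits d) t)
    ... | h , gh≡1 = h , modₚ-≡⇒≡-mod (eqᵇ-sound _ _ gh≡1)
    complete : Unit f g → T (isUnitᵇ f g)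
    complete (u , gu≡1) = any⁺ inverts (lose u′∈allBits inverts-u′)
      where
      u′ = modₚ f u
      u′∈allBits : u′ ∈ allBits d
      u′∈allBits = subst (λ k → u′ ∈ allBits k) (length-modₚ u) (∈-allBits u′)
      inverts-u′ : T (inverts u′)
      inverts-u′ = subst (λ r → T (eqᵇ r (modₚ f 1ₚ))) (sym (≡-mod⇒modₚ-≡ (≡-mod-trans (≡-mod-*ˡ g (modₚ-≡ u)) gu≡1)))
                         (eqᵇ-refl (modₚ f 1ₚ))

open Residues using (lowPart-length; ∷ʳ1-+-lowPart; ∷ʳ-≡-mod; isUnitᵇ⇔Unit)

T-⇔⇒≡ : ∀ {a b} → T a ⇔ T b → a ≡ b
T-⇔⇒≡ {false} {false} _   = refl
T-⇔⇒≡ {false} {true}  a⇔b = ⊥-elim (Equivalence.from a⇔b tt)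
T-⇔⇒≡ {true}  {false} a⇔b = ⊥-elim (Equivalence.to a⇔b tt)
T-⇔⇒≡ {true}  {true}  _   = refl

isUnitᵇ-resp-≡-mod : ∀ {f} → NormalMonic f → ∀ {a b} → a ≡ b mod f → isUnitᵇ f a ≡ isUnitᵇ f b
isUnitᵇ-resp-≡-mod f-nm {a} {b} a≡b = T-⇔⇒≡ $
  ⇔-trans (isUnitᵇ⇔Unit f-nm a) (⇔-trans (Unit-cong a≡b) (⇔-sym (isUnitᵇ⇔Unit f-nm b)))

isUnitᵇ-x+*-root : ∀ c {h} → NormalMonic h → ev c h ≡ false → ∀ r → isUnitᵇ (x+ c *ₚ h) r ≡ isUnitᵇ h r
isUnitᵇ-x+*-root c h-nm evh≡0 r = T-⇔⇒≡ $
  ⇔-trans (isUnitᵇ⇔Unit (x+*-normalMonic c h-nm) r) (⇔-trans (Unit-x+*-root c evh≡0) (⇔-sym (isUnitᵇ⇔Unit h-nm r)))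

isUnitᵇ-x+*-coprime : ∀ c {h} → NormalMonic h → ev c h ≡ true → ∀ r → isUnitᵇ (x+ c *ₚ h) r ≡ isUnitᵇ h r ∧ ev c r
isUnitᵇ-x+*-coprime c h-nm evh≡1 r = T-⇔⇒≡ $
  ⇔-trans (isUnitᵇ⇔Unit (x+*-normalMonic c h-nm) r) (⇔-trans (Unit-x+*-coprime c evh≡1)
  (⇔-trans (⇔-sym (isUnitᵇ⇔Unit h-nm r) ×-⇔ ⇔-sym T-≡) (⇔-sym T-∧)))

-- Counting units

open CommutativeSemigroupProperties ℕ.+-commutativeSemigroup using () renaming (interchange to +-interchange-ℕ)

count : (List Bool → Bool) → ℕ → ℕ
count P d = length (filterᵇ P (allBits d))

length-filterᵇ-map : ∀ P (g : List Bool → List Bool) xs → length (filterᵇ P (map g xs)) ≡ length (filterᵇ (P ∘ g) xs)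
length-filterᵇ-map P g []       = refl
length-filterᵇ-map P g (x ∷ xs) with P (g x)
... | true  = cong suc (length-filterᵇ-map P g xs)
... | false = length-filterᵇ-map P g xs

length-filterᵇ-split : ∀ (P Q : List Bool → Bool) xs →
  length (filterᵇ P xs) ≡ length (filterᵇ (λ x → P x ∧ Q x) xs) + length (filterᵇ (λ x → P x ∧ not (Q x)) xs)
length-filterᵇ-split P Q []       = refl
length-filterᵇ-split P Q (x ∷ xs) with P x | Q x
... | true  | true  = cong suc (length-filterᵇ-split P Q xs)
... | true  | false = trans (cong suc (length-filterᵇ-split P Q xs)) (sym (ℕ.+-suc _ _))
... | false | _     = length-filterᵇ-split P Q xs

count-cons : ∀ P d → count P (suc d) ≡ count (P ∘ (false ∷_)) d + count (P ∘ (true ∷_)) d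
count-cons P d = begin
  length (filterᵇ P (map (false ∷_) (allBits d) ++ map (true ∷_) (allBits d)))
    ≡⟨ cong length (filter-++ (T? ∘ P) (map (false ∷_) (allBits d)) _) ⟩
  length (filterᵇ P (map (false ∷_) (allBits d)) ++ filterᵇ P (map (true ∷_) (allBits d)))
    ≡⟨ length-++ (filterᵇ P (map (false ∷_) (allBits d))) ⟩
  length (filterᵇ P (map (false ∷_) (allBits d))) + length (filterᵇ P (map (true ∷_) (allBits d)))
    ≡⟨ cong₂ _+_ (length-filterᵇ-map P (false ∷_) (allBits d)) (length-filterᵇ-map P (true ∷_) (allBits d)) ⟩
  count (P ∘ (false ∷_)) d + count (P ∘ (true ∷_)) d
    ∎
  where open ≡-Reasoning

count-cong : ∀ {P Q} d → (∀ r → length r ≡ d → P r ≡ Q r) → count P d ≡ count Q d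
count-cong {P} {Q} zero    P≗Q with P [] | Q [] | P≗Q [] refl
... | true  | true  | _ = refl
... | false | false | _ = refl
count-cong {P} {Q} (suc d) P≗Q = begin
  count P (suc d)                                       ≡⟨ count-cons P d ⟩
  count (P ∘ (false ∷_)) d + count (P ∘ (true ∷_)) d    ≡⟨ cong₂ _+_ (count-cong d λ r |r| → P≗Q (false ∷ r) (cong suc |r|))
                                                                     (count-cong d λ r |r| → P≗Q (true ∷ r) (cong suc |r|)) ⟩
  count (Q ∘ (false ∷_)) d + count (Q ∘ (true ∷_)) d    ≡⟨ count-cons Q d ⟨
  count Q (suc d)                                       ∎
  where open ≡-Reasoning

count-snoc : ∀ P d → count P (suc d) ≡ count (P ∘ (_∷ʳ false)) d + count (P ∘ (_∷ʳ true)) d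
count-snoc P zero    =
  trans (count-cons P zero) (cong₂ _+_ (count-cong {P ∘ (false ∷_)} {P ∘ (_∷ʳ false)} 0 λ { [] _ → refl })
                                       (count-cong {P ∘ (true ∷_)} {P ∘ (_∷ʳ true)} 0 λ { [] _ → refl }))
count-snoc P (suc d) = begin
  count P (suc (suc d))
    ≡⟨ count-cons P (suc d) ⟩
  count (P ∘ (false ∷_)) (suc d) + count (P ∘ (true ∷_)) (suc d)
    ≡⟨ cong₂ _+_ (count-snoc (P ∘ (false ∷_)) d) (count-snoc (P ∘ (true ∷_)) d) ⟩
  (count (λ r → P (false ∷ r ∷ʳ false)) d + count (λ r → P (false ∷ r ∷ʳ true)) d) +
  (count (λ r → P (true ∷ r ∷ʳ false)) d + count (λ r → P (true ∷ r ∷ʳ true)) d)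
    ≡⟨ +-interchange-ℕ (count (λ r → P (false ∷ r ∷ʳ false)) d) _ _ _ ⟩
  (count (λ r → P (false ∷ r ∷ʳ false)) d + count (λ r → P (true ∷ r ∷ʳ false)) d) +
  (count (λ r → P (false ∷ r ∷ʳ true)) d + count (λ r → P (true ∷ r ∷ʳ true)) d)
    ≡⟨ cong₂ _+_ (count-cons (P ∘ (_∷ʳ false)) d) (count-cons (P ∘ (_∷ʳ true)) d) ⟨
  count (P ∘ (_∷ʳ false)) (suc d) + count (P ∘ (_∷ʳ true)) (suc d)
    ∎
  where open ≡-Reasoning

count-translate : ∀ P d {c} → length c ≡ d → count P d ≡ count (λ r → P (r +ₚ c)) d
count-translate P zero    {[]}     _     = count-cong {P} {λ r → P (r +ₚ [])} 0 λ { [] _ → refl }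
count-translate P (suc d) {c₀ ∷ c} |c|≡d = begin
  count P (suc d)
    ≡⟨ count-cons P d ⟩
  count (P ∘ (false ∷_)) d + count (P ∘ (true ∷_)) d
    ≡⟨ cong₂ _+_ (count-translate (P ∘ (false ∷_)) d |c|) (count-translate (P ∘ (true ∷_)) d |c|) ⟩
  count (λ r → P (false ∷ r +ₚ c)) d + count (λ r → P (true ∷ r +ₚ c)) d
    ≡⟨ flip c₀ ⟩
  count (λ r → P ((false xor c₀) ∷ r +ₚ c)) d + count (λ r → P ((true xor c₀) ∷ r +ₚ c)) d
    ≡⟨ count-cons (λ r → P (r +ₚ (c₀ ∷ c))) d ⟨
  count (λ r → P (r +ₚ (c₀ ∷ c))) (suc d)
    ∎
  where
  open ≡-Reasoning
  |c| = ℕ.suc-injective |c|≡d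
  flip : ∀ c₀ → count (λ r → P (false ∷ r +ₚ c)) d + count (λ r → P (true ∷ r +ₚ c)) d
              ≡ count (λ r → P ((false xor c₀) ∷ r +ₚ c)) d + count (λ r → P ((true xor c₀) ∷ r +ₚ c)) d
  flip false = refl
  flip true  = ℕ.+-comm (count (λ r → P (false ∷ r +ₚ c)) d) _

count-split : ∀ P Q d → count P d ≡ count (λ r → P r ∧ Q r) d + count (λ r → P r ∧ not (Q r)) d
count-split P Q d = length-filterᵇ-split P Q (allBits d)

deg-x+* : ∀ c {h} → NormalMonic h → deg (x+ c *ₚ h) ≡ suc (deg h)
deg-x+* c (L , refl) with *-∷ʳ1 (c ∷ []) L
... | N , x+cL≡N∷ʳ1 , |N| = trans (cong deg x+cL≡N∷ʳ1) (trans (deg-∷ʳ1 N) (trans |N| (cong suc (sym (deg-∷ʳ1 L)))))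

Φ-x+*-root : ∀ c {h} → NormalMonic h → ev c h ≡ false → Φ (x+ c *ₚ h) ≡ Φ h + Φ h
Φ-x+*-root c {h} h-nm evh≡0 = begin
  Φ (x+ c *ₚ h)
    ≡⟨ cong (count _) (deg-x+* c h-nm) ⟩
  count (isUnitᵇ (x+ c *ₚ h)) (suc d)
    ≡⟨ count-cong (suc d) (λ r _ → isUnitᵇ-x+*-root c h-nm evh≡0 r) ⟩
  count U (suc d)
    ≡⟨ count-snoc U d ⟩
  count (U ∘ (_∷ʳ false)) d + count (U ∘ (_∷ʳ true)) d
    ≡⟨ cong₂ _+_ (count-cong d (top-bit false)) (count-cong d (top-bit true)) ⟩
  Φ h + count (λ s → U (s +ₚ L)) d
    ≡⟨ cong (Φ h +_) (count-translate U d (lowPart-length h-nm)) ⟨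
  Φ h + Φ h
    ∎
  where
  open ≡-Reasoning
  d = deg h
  L = lowPart h
  U = isUnitᵇ h
  top-bit : ∀ b s → length s ≡ d → U (s ∷ʳ b) ≡ U (if b then s +ₚ L else s)
  top-bit b s |s|≡d = isUnitᵇ-resp-≡-mod h-nm (∷ʳ-≡-mod h-nm b s |s|≡d)

Φ-x+*-coprime : ∀ c {h} → NormalMonic h → ev c h ≡ true → Φ (x+ c *ₚ h) ≡ Φ h
Φ-x+*-coprime c {h} h-nm evh≡1 = begin
  Φ (x+ c *ₚ h)
    ≡⟨ cong (count _) (deg-x+* c h-nm) ⟩
  count (isUnitᵇ (x+ c *ₚ h)) (suc d)
    ≡⟨ count-cong (suc d) (λ r _ → isUnitᵇ-x+*-coprime c h-nm evh≡1 r) ⟩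
  count (λ r → U r ∧ ev c r) (suc d)
    ≡⟨ count-snoc (λ r → U r ∧ ev c r) d ⟩
  count (λ s → U (s ∷ʳ false) ∧ ev c (s ∷ʳ false)) d + count (λ s → U (s ∷ʳ true) ∧ ev c (s ∷ʳ true)) d
    ≡⟨ cong₂ _+_ (count-cong d top-bit-0) (count-cong d top-bit-1) ⟩
  count (λ s → U s ∧ ev c s) d + count (λ s → U (s +ₚ L) ∧ not (ev c (s +ₚ L))) d
    ≡⟨ cong (count (λ s → U s ∧ ev c s) d +_) (count-translate (λ s → U s ∧ not (ev c s)) d (lowPart-length h-nm)) ⟨
  count (λ s → U s ∧ ev c s) d + count (λ s → U s ∧ not (ev c s)) d
    ≡⟨ count-split U (ev c) d ⟨
  Φ h
    ∎
  where
  open ≡-Reasoning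
  d = deg h
  L = lowPart h
  U = isUnitᵇ h
  top-bit-0 : ∀ s → length s ≡ d → U (s ∷ʳ false) ∧ ev c (s ∷ʳ false) ≡ U s ∧ ev c s
  top-bit-0 s |s|≡d = cong₂ _∧_ (isUnitᵇ-resp-≡-mod h-nm (∷ʳ-≡-mod h-nm false s |s|≡d)) (ev-cong c (∷ʳ0-≈ s))
  -- s ∷ʳ 1 and s + L differ by h, and h(c) = 1
  top-bit-1 : ∀ s → length s ≡ d → U (s ∷ʳ true) ∧ ev c (s ∷ʳ true) ≡ U (s +ₚ L) ∧ not (ev c (s +ₚ L))
  top-bit-1 s |s|≡d = cong₂ _∧_ (isUnitᵇ-resp-≡-mod h-nm (∷ʳ-≡-mod h-nm true s |s|≡d)) (xor≡1⇒≡not (begin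
    ev c (s ∷ʳ true) xor ev c (s +ₚ L)   ≡⟨ ev-+ c (s ∷ʳ true) (s +ₚ L) ⟨
    ev c ((s ∷ʳ true) +ₚ (s +ₚ L))       ≡⟨ cong (ev c) (∷ʳ1-+-lowPart h-nm s |s|≡d) ⟩
    ev c h                               ≡⟨ evh≡1 ⟩
    true                                 ∎))

-- The factorisation f = xᵃ(x + 1)ᵇg

infixr 8 [x+_]^_·_
[x+_]^_·_ : Bool → ℕ → Poly → Poly
[x+ c ]^ zero  · h = h
[x+ c ]^ suc a · h = x+ c *ₚ ([x+ c ]^ a · h)

[x+]^-normalMonic : ∀ c a {h} → NormalMonic h → NormalMonic ([x+ c ]^ a · h)
[x+]^-normalMonic c zero    h-nm = h-nm
[x+]^-normalMonic c (suc a) h-nm = x+*-normalMonic c ([x+]^-normalMonic c a h-nm)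

length-[x+]^ : ∀ c a {h} → NormalMonic h → length ([x+ c ]^ a · h) ≡ a + length h
length-[x+]^ c zero    h-nm = refl
length-[x+]^ c (suc a) h-nm = trans (length-x+* c ([x+]^-normalMonic c a h-nm)) (cong suc (length-[x+]^ c a h-nm))

ev-not-[x+]^ : ∀ c a h → ev (not c) ([x+ c ]^ a · h) ≡ ev (not c) h
ev-not-[x+]^ c zero    h = refl
ev-not-[x+]^ c (suc a) h = begin
  ev (not c) (x+ c *ₚ [x+ c ]^ a · h)               ≡⟨ ev-* (not c) (x+ c) ([x+ c ]^ a · h) ⟩
  ev (not c) (x+ c) ∧ ev (not c) ([x+ c ]^ a · h)   ≡⟨ cong₂ _∧_ (ev-x+-not c) (ev-not-[x+]^ c a h) ⟩
  ev (not c) h                                      ∎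
  where open ≡-Reasoning

Φ[x^_] : ℕ → ℕ
Φ[x^ zero  ] = 1
Φ[x^ suc a ] = 2 ^ a

Φ-[x+]^ : ∀ c a {h} → NormalMonic h → ev c h ≡ true → Φ ([x+ c ]^ a · h) ≡ Φ[x^ a ] * Φ h
Φ-[x+]^ c zero          {h} h-nm evh≡1 = sym (ℕ.*-identityˡ (Φ h))
Φ-[x+]^ c (suc zero)    {h} h-nm evh≡1 = trans (Φ-x+*-coprime c h-nm evh≡1) (sym (ℕ.*-identityˡ (Φ h)))
Φ-[x+]^ c (suc (suc a)) {h} h-nm evh≡1 = begin
  Φ (x+ c *ₚ p)                    ≡⟨ Φ-x+*-root c ([x+]^-normalMonic c (suc a) h-nm) (ev-x+* c ([x+ c ]^ a · h)) ⟩
  Φ p + Φ p                        ≡⟨ cong (λ n → n + n) (Φ-[x+]^ c (suc a) h-nm evh≡1) ⟩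
  2 ^ a * Φ h + 2 ^ a * Φ h        ≡⟨ cong (2 ^ a * Φ h +_) (ℕ.+-identityʳ (2 ^ a * Φ h)) ⟨
  2 * (2 ^ a * Φ h)                ≡⟨ ℕ.*-assoc 2 (2 ^ a) (Φ h) ⟨
  2 ^ suc a * Φ h                  ∎
  where
  open ≡-Reasoning
  p = [x+ c ]^ suc a · h

Φ[x^]-* : ∀ a b → ∃[ K ] Φ[x^ a ] * Φ[x^ b ] ≡ Φ[x^ K ]
Φ[x^]-* zero    b       = b , ℕ.+-identityʳ Φ[x^ b ]
Φ[x^]-* (suc a) zero    = suc a , ℕ.*-identityʳ (2 ^ a)
Φ[x^]-* (suc a) (suc b) = suc (a + b) , sym (ℕ.^-distribˡ-+-* 2 a b)

ord₀ : Poly → ℕ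
ord₀ []          = 0
ord₀ (true ∷ p)  = 0
ord₀ (false ∷ p) = suc (ord₀ p)

x*-∷ : ∀ a q → x+ false *ₚ (a ∷ q) ≡ false ∷ a ∷ q
x*-∷ a q = cong₂ (λ b r → false ∷ b ∷ r) (xor-identityʳ a) (+ₚ-identityʳ q)

ord₀-x* : ∀ {h} → NormalMonic h → ord₀ (x+ false *ₚ h) ≡ suc (ord₀ h)
ord₀-x* ([]    , refl) = refl
ord₀-x* (b ∷ L , refl) = cong ord₀ (x*-∷ b (L ∷ʳ true))

ord₀-[x]^ : ∀ a {h} → NormalMonic h → ord₀ ([x+ false ]^ a · h) ≡ a + ord₀ h
ord₀-[x]^ zero    h-nm = refl
ord₀-[x]^ (suc a) h-nm = trans (ord₀-x* ([x+]^-normalMonic false a h-nm)) (cong suc (ord₀-[x]^ a h-nm))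

ord₀-coprime : ∀ {h} → ev false h ≡ true → ord₀ h ≡ 0
ord₀-coprime {[]}        _ = refl
ord₀-coprime {true ∷ h}  _ = refl
ord₀-coprime {false ∷ h} ()

normalMonic-length : ∀ {f} → NormalMonic f → 1 ≤ length f
normalMonic-length (L , refl) = ℕ.≤-trans (ℕ.m≤n+m 1 (length L)) (ℕ.≤-reflexive (sym (length-++ L)))

factor-normalMonic : ∀ c {f} → NormalMonic f → ev c f ≡ false → ∃[ q ] NormalMonic q × f ≡ x+ c *ₚ q
factor-normalMonic c f-nm@(L , f≡L∷ʳ1) evf≡0 with factor c evf≡0
... | q , qx+c≈f with ≈0-or-normalMonic q
...   | inj₁ q≈0 =
        contradiction (≈-trans (≈-reflexive (sym f≡L∷ʳ1)) (≈-trans (≈-sym qx+c≈f) (*-zeroˡ-≈ (x+ c) q≈0))) (∷ʳ1-≉0 L)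
...   | inj₂ (q′ , q′-nm , q′≈q) = q′ , q′-nm , normalMonic-≈⇒≡ f-nm (x+*-normalMonic c q′-nm)
        (≈-trans (≈-sym qx+c≈f) (≈-trans (*-comm q (x+ c)) (*-congˡ (x+ c) (≈-sym q′≈q))))

strip : ∀ c n {f} → NormalMonic f → length f ≤ n →
        ∃[ a ] ∃[ g ] NormalMonic g × ev c g ≡ true × f ≡ [x+ c ]^ a · g
strip c n       {f} f-nm |f|≤n with ev c f in evf≡b
strip c n       {f} f-nm |f|≤n | true  = 0 , f , f-nm , evf≡b , refl
strip c zero        f-nm |f|≤0 | false = contradiction (ℕ.≤-trans (normalMonic-length f-nm) |f|≤0) λ ()
strip c (suc n)     f-nm |f|≤n | false with factor-normalMonic c f-nm evf≡b
... | q , q-nm , refl with strip c n q-nm (ℕ.≤-pred (subst (_≤ suc n) (length-x+* c q-nm) |f|≤n))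
...   | a , g , g-nm , evg≡1 , refl = suc a , g , g-nm , evg≡1 , refl

record Factorisation (f : Poly) : Set where
  constructor factorisation
  field
    a b    : ℕ
    g      : Poly
    g-nm   : NormalMonic g
    g[0]≡1 : ev false g ≡ true
    g[1]≡1 : ev true g ≡ true
    f≡     : f ≡ [x+ false ]^ a · [x+ true ]^ b · g

factorise : ∀ {f} → NormalMonic f → Factorisation f
factorise {f} f-nm with strip false (length f) f-nm ℕ.≤-refl
... | a , f₁ , f₁-nm , f₁[0]≡1 , f≡ with strip true (length f₁) f₁-nm ℕ.≤-refl
... | b , g , g-nm , g[1]≡1 , f₁≡ =
  factorisation a b g g-nm (trans (sym (ev-not-[x+]^ true b g)) (trans (cong (ev false) (sym f₁≡)) f₁[0]≡1)) g[1]≡1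
                (trans f≡ (cong ([x+ false ]^ a ·_) f₁≡))

ThreePreimages : ℕ → Set
ThreePreimages n = ∃[ f₁ ] ∃[ f₂ ] ∃[ f₃ ]
  (InPreimage n f₁ × InPreimage n f₂ × InPreimage n f₃ × f₁ ≢ f₂ × f₁ ≢ f₃ × f₂ ≢ f₃)

FourPreimages : ℕ → Set
FourPreimages n = ∃[ f₁ ] ∃[ f₂ ] ∃[ f₃ ] ∃[ f₄ ]
  (InPreimage n f₁ × InPreimage n f₂ × InPreimage n f₃ × InPreimage n f₄ ×
   f₁ ≢ f₂ × f₁ ≢ f₃ × f₁ ≢ f₄ × f₂ ≢ f₃ × f₂ ≢ f₄ × f₃ ≢ f₄)

four⇒three : ∀ {n} → FourPreimages n → ThreePreimages n
four⇒three (f₁ , f₂ , f₃ , _ , p₁ , p₂ , p₃ , _ , f₁≢f₂ , f₁≢f₃ , _ , f₂≢f₃ , _) =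
  f₁ , f₂ , f₃ , p₁ , p₂ , p₃ , f₁≢f₂ , f₁≢f₃ , f₂≢f₃

ManyPreimages : ℕ → Set
ManyPreimages n = ThreePreimages n × (n ≢ 1 → FourPreimages n)

four⇒many : ∀ {n} → FourPreimages n → ManyPreimages n
four⇒many four = four⇒three four , λ _ → four

threePreimagesOf1 : ThreePreimages 1
threePreimagesOf1 =
  x+ false , x+ true , x+ false *ₚ x+ true ,
  (refl , refl , s≤s (s≤s z≤n) , refl) , (refl , refl , s≤s (s≤s z≤n) , refl) , (refl , refl , s≤s (s≤s z≤n) , refl) ,
  (λ ()) , (λ ()) , (λ ())

normalMonic⇒InPreimage : ∀ {f} → NormalMonic f → 2 ≤ length f → InPreimage (Φ f) f
normalMonic⇒InPreimage (L , refl) 2≤|f| = normalize-∷ʳ1 L , lead-∷ʳ1 L , 2≤|f| , refl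

normalMonic-1-or-long : ∀ {g} → NormalMonic g → g ≡ 1ₚ ⊎ 2 ≤ length g
normalMonic-1-or-long ([]    , refl) = inj₁ refl
normalMonic-1-or-long (_ ∷ L , refl) = inj₂ (s≤s (normalMonic-length (L , refl)))

module Candidates {g : Poly} (g-nm : NormalMonic g) (g[0]≡1 : ev false g ≡ true) (g[1]≡1 : ev true g ≡ true) where

  candidate : ℕ → ℕ → Poly
  candidate a b = [x+ false ]^ a · [x+ true ]^ b · g

  candidate-normalMonic : ∀ a b → NormalMonic (candidate a b)
  candidate-normalMonic a b = [x+]^-normalMonic false a ([x+]^-normalMonic true b g-nm)

  Φ-candidate : ∀ a b → Φ (candidate a b) ≡ Φ[x^ a ] * (Φ[x^ b ] * Φ g)
  Φ-candidate a b = trans (Φ-[x+]^ false a ([x+]^-normalMonic true b g-nm) (trans (ev-not-[x+]^ true b g) g[0]≡1))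
                     (cong (Φ[x^ a ] *_) (Φ-[x+]^ true b g-nm g[1]≡1))

  length-candidate : ∀ a b → length (candidate a b) ≡ a + (b + length g)
  length-candidate a b =
    trans (length-[x+]^ false a ([x+]^-normalMonic true b g-nm)) (cong (a +_) (length-[x+]^ true b g-nm))

  ord₀-candidate : ∀ a b → ord₀ (candidate a b) ≡ a
  ord₀-candidate a b = trans (ord₀-[x]^ a ([x+]^-normalMonic true b g-nm))
                        (trans (cong (a +_) (ord₀-coprime (trans (ev-not-[x+]^ true b g) g[0]≡1))) (ℕ.+-identityʳ a))

  candidate-≢ : ∀ a b a′ b′ → (a , b) ≢ (a′ , b′) → candidate a b ≢ candidate a′ b′
  candidate-≢ a b a′ b′ ab≢a′b′ candidate≡ = ab≢a′b′ (cong₂ _,_ a≡a′ b≡b′)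
    where
    a≡a′ : a ≡ a′
    a≡a′ = trans (sym (ord₀-candidate a b)) (trans (cong ord₀ candidate≡) (ord₀-candidate a′ b′))
    b≡b′ : b ≡ b′
    b≡b′ = ℕ.+-cancelʳ-≡ (length g) b b′ (ℕ.+-cancelˡ-≡ a′ (b + length g) (b′ + length g) (begin
      a′ + (b + length g)        ≡⟨ cong (_+ (b + length g)) a≡a′ ⟨
      a + (b + length g)         ≡⟨ length-candidate a b ⟨
      length (candidate a b)     ≡⟨ cong length candidate≡ ⟩
      length (candidate a′ b′)   ≡⟨ length-candidate a′ b′ ⟩
      a′ + (b′ + length g)       ∎))
      where open ≡-Reasoning

  preimage : ∀ {n} a b → 2 ≤ a + (b + length g) → Φ[x^ a ] * (Φ[x^ b ] * Φ g) ≡ n → InPreimage n (candidate a b)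
  preimage a b 2≤ refl = subst (λ m → InPreimage m (candidate a b)) (Φ-candidate a b)
    (normalMonic⇒InPreimage (candidate-normalMonic a b) (subst (2 ≤_) (sym (length-candidate a b)) 2≤))

  fourPreimages-large : ∀ k → FourPreimages (Φ[x^ suc (suc k) ] * Φ g)
  fourPreimages-large k =
    candidate K 0 , candidate K 1 , candidate 0 K , candidate 1 K ,
    preimage K 0 (s≤s (s≤s z≤n)) (cong (Φ[x^ K ] *_) (ℕ.*-identityˡ (Φ g))) ,
    preimage K 1 (s≤s (s≤s z≤n)) (cong (Φ[x^ K ] *_) (ℕ.*-identityˡ (Φ g))) ,
    preimage 0 K (s≤s (s≤s z≤n)) (ℕ.*-identityˡ (Φ[x^ K ] * Φ g)) ,
    preimage 1 K (s≤s (s≤s z≤n)) (ℕ.*-identityˡ (Φ[x^ K ] * Φ g)) ,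
    candidate-≢ K 0 K 1 (λ ()) , candidate-≢ K 0 0 K (λ ()) , candidate-≢ K 0 1 K (λ ()) ,
    candidate-≢ K 1 0 K (λ ()) , candidate-≢ K 1 1 K (λ ()) , candidate-≢ 0 K 1 K (λ ())
    where K = suc (suc k)

  fourPreimages-small : 2 ≤ length g → FourPreimages (Φ g)
  fourPreimages-small 2≤|g| =
    candidate 0 0 , candidate 1 0 , candidate 0 1 , candidate 1 1 ,
    preimage 0 0 (2≤ 0 0) Φ≡ , preimage 1 0 (2≤ 1 0) Φ≡ , preimage 0 1 (2≤ 0 1) Φ≡ , preimage 1 1 (2≤ 1 1) Φ≡ ,
    candidate-≢ 0 0 1 0 (λ ()) , candidate-≢ 0 0 0 1 (λ ()) , candidate-≢ 0 0 1 1 (λ ()) ,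
    candidate-≢ 1 0 0 1 (λ ()) , candidate-≢ 1 0 1 1 (λ ()) , candidate-≢ 0 1 1 1 (λ ())
    where
    Φ≡ : 1 * (1 * Φ g) ≡ Φ g
    Φ≡ = trans (ℕ.*-identityˡ (1 * Φ g)) (ℕ.*-identityˡ (Φ g))
    2≤ : ∀ a b → 2 ≤ a + (b + length g)
    2≤ a b = ℕ.≤-trans 2≤|g| (ℕ.≤-trans (ℕ.m≤n+m (length g) b) (ℕ.m≤n+m (b + length g) a))

  manyPreimages-Φg : ManyPreimages (Φ g)
  manyPreimages-Φg with normalMonic-1-or-long g-nm
  ... | inj₁ g≡1   = subst ManyPreimages (sym (cong Φ g≡1)) (threePreimagesOf1 , λ 1≢1 → contradiction refl 1≢1)
  ... | inj₂ 2≤|g| = four⇒many (fourPreimages-small 2≤|g|)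

  manyPreimages : ∀ K → ManyPreimages (Φ[x^ K ] * Φ g)
  manyPreimages zero          = subst ManyPreimages (sym (ℕ.*-identityˡ (Φ g))) manyPreimages-Φg
  manyPreimages (suc zero)    = subst ManyPreimages (sym (ℕ.*-identityˡ (Φ g))) manyPreimages-Φg
  manyPreimages (suc (suc k)) = four⇒many (fourPreimages-large k)

normal⇒normalMonic : ∀ {f} → Normal f → NonConst f → NormalMonic f
normal⇒normalMonic {f} f-normal f-nonconst with normalize-view f
... | inj₁ nf≡[] = contradiction (subst (λ p → 2 ≤ length p) (trans (sym f-normal) nf≡[]) f-nonconst) λ ()
... | inj₂ nf-nm = subst NormalMonic f-normal nf-nm

mainTheorem5 : (n : ℕ) → InImage n →
    (∃[ f₁ ] ∃[ f₂ ] ∃[ f₃ ]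
      (InPreimage n f₁ × InPreimage n f₂ × InPreimage n f₃ ×
       f₁ ≢ f₂ × f₁ ≢ f₃ × f₂ ≢ f₃))
    × (n ≢ 1 →
      ∃[ f₁ ] ∃[ f₂ ] ∃[ f₃ ] ∃[ f₄ ]
        (InPreimage n f₁ × InPreimage n f₂ × InPreimage n f₃ × InPreimage n f₄ ×
         f₁ ≢ f₂ × f₁ ≢ f₃ × f₁ ≢ f₄ × f₂ ≢ f₃ × f₂ ≢ f₄ × f₃ ≢ f₄))
mainTheorem5 _ (f , f-normal , f-nonconst , refl) =
  subst ManyPreimages (sym Φf≡Φ[x^K]*Φg) (manyPreimages K)
  where
  open Factorisation (factorise (normal⇒normalMonic f-normal f-nonconst))
  open Candidates g-nm g[0]≡1 g[1]≡1
  K = proj₁ (Φ[x^]-* a b)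
  Φf≡Φ[x^K]*Φg : Φ f ≡ Φ[x^ K ] * Φ g
  Φf≡Φ[x^K]*Φg = begin
    Φ f                            ≡⟨ cong Φ f≡ ⟩
    Φ (candidate a b)              ≡⟨ Φ-candidate a b ⟩
    Φ[x^ a ] * (Φ[x^ b ] * Φ g)    ≡⟨ ℕ.*-assoc Φ[x^ a ] Φ[x^ b ] (Φ g) ⟨
    Φ[x^ a ] * Φ[x^ b ] * Φ g      ≡⟨ cong (_* Φ g) (proj₂ (Φ[x^]-* a b)) ⟩
    Φ[x^ K ] * Φ g                 ∎
    where open ≡-Reasoning
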